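{- In a bay with $C$ columns, for any configuration $B$ with at most $C+k$ containers: if $k=2$ then $z_H(B) \le z_{opt}(B) + 2$; and if $3 \le k \le C$ then $z_H(B) \le z_{opt}(B) + \frac{k(k+1)}{2}$.
   Context: A bay has $C$ columns and $P$ tiers with $C\ge P\ge 3$; each column is a stack of at most $P$ containers. Containers have distinct labels giving retrieval order; $N$ is the largest label. The target is the smallest label present; a retrieval removes it when topmost. In the restricted CRP a relocation is allowed only when the target is not topmost, moving the topmost container of the target's column to the top of another column with fewer than $P$ containers. $z_{opt}(B)$ is the minimum number of relocations to retrieve all containers in order. $\min(c_i)$ is the smallest label of column $c_i$ ($N+1$ if empty). Heuristic H: while nonempty, if the target is topmost retrieve it; otherwise let $c$ be its column and $r$ the topmost container of $c$; among columns $c_i\ne c$ with fewer than $P$ containers, if some has $\min(c_i)>r$ move $r$ to one minimizing $\min(c_i)$, else to one maximizing $\min(c_i)$ (ties arbitrary). $z_H(B)$ is the number of relocations of H. -}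

module Defs where

open import Data.Nat using (ℕ; zero; suc; _+_; _≤_; _<_; _⊓_; _⊔_)
open import Data.List using (List; []; _∷_; length; concat)
open import Data.List.Membership.Propositional using (_∈_)
open import Data.List.Relation.Unary.All as LAll using ()
open import Data.List.Relation.Unary.Unique.Propositional using (Unique)
open import Data.Vec using (Vec; lookup; toList; _[_]≔_)
open import Data.Vec.Relation.Unary.All as VAll using ()
open import Data.Fin using (Fin)
open import Data.Product using (_×_; Σ-syntax)
open import Data.Sum using (_⊎_)
open import Relation.Binary.PropositionalEquality using (_≡_; _≢_)

-- A bay with C columns: column i is a list, head = topmost container.
Bay : ℕ → Set
Bay C = Vec (List ℕ) C

module _ {C : ℕ} where

  labels : Bay C → List ℕ
  labels B = concat (toList B)

  size : Bay C → ℕ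
  size B = length (labels B)

  WellFormed : ℕ → Bay C → Set
  WellFormed P B = VAll.All (λ col → length col ≤ P) B × Unique (labels B)

  IsTarget : Bay C → ℕ → Set
  IsTarget B t = t ∈ labels B × LAll.All (t ≤_) (labels B)

  maxLabel : Bay C → ℕ
  maxLabel B = Data.List.foldr _⊔_ 0 (labels B)

  -- min(c_i): smallest label of column, N+1 if empty
  colMin : Bay C → Fin C → ℕ
  colMin B i = Data.List.foldr _⊓_ (suc (maxLabel B)) (lookup B i)

  record Retrieval (B B' : Bay C) : Set where
    field
      t    : ℕ
      c    : Fin C
      rest : List ℕ
      isTarget : IsTarget B t
      top  : lookup B c ≡ t ∷ rest
      next : B' ≡ B [ c ]≔ rest

  Cand : ℕ → Bay C → Fin C → Fin C → Set
  Cand P B c e = e ≢ c × length (lookup B e) < P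

  record Relocation (P : ℕ) (Choice : Bay C → Fin C → ℕ → Fin C → Set)
                    (B B' : Bay C) : Set where
    field
      t    : ℕ
      c    : Fin C
      r    : ℕ
      rest : List ℕ
      d    : Fin C
      isTarget : IsTarget B t
      top  : lookup B c ≡ r ∷ rest
      notTop : t ∈ rest
      cand : Cand P B c d
      choice : Choice B c r d
      next : B' ≡ (B [ c ]≔ rest) [ d ]≔ (r ∷ lookup B d)

  AnyChoice : Bay C → Fin C → ℕ → Fin C → Set
  AnyChoice _ _ _ _ = ⊤′
    where open import Data.Unit using () renaming (⊤ to ⊤′)

  HChoice : ℕ → Bay C → Fin C → ℕ → Fin C → Set
  HChoice P B c r d =
      (r < colMin B d
        × (∀ e → Cand P B c e → r < colMin B e → colMin B d ≤ colMin B e))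
    ⊎ ((∀ e → Cand P B c e → colMin B e ≤ r)
        × (∀ e → Cand P B c e → colMin B e ≤ colMin B d))

  data Run (P : ℕ) (Choice : Bay C → Fin C → ℕ → Fin C → Set)
           : Bay C → ℕ → Set where
    done : ∀ {B} → labels B ≡ [] → Run P Choice B 0
    retr : ∀ {B B' n} → Retrieval B B' → Run P Choice B' n → Run P Choice B n
    relo : ∀ {B B' n} → Relocation P Choice B B' → Run P Choice B' n
         → Run P Choice B (suc n)

  Solves : ℕ → Bay C → ℕ → Set
  Solves P = Run P AnyChoice

  -- a complete run of heuristic H (any tie-breaking) with n relocations
  HRun : ℕ → Bay C → ℕ → Set
  HRun P = Run P (HChoice P)

  IsZopt : ℕ → Bay C → ℕ → Set
  IsZopt P B z = Solves P B z × (∀ m → Solves P B m → z ≤ m)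

module Submission where

-- Call a container blocking if a smaller label lies below it in its column. Every solution
-- relocates each blocking container at least once, so their number LB bounds z_opt from below.
-- A move of H onto a column whose minimum exceeds r (a good move) lowers LB; a bad move keeps
-- LB but lowers the number s of containers above the target, and since every column is then
-- nonempty, s is at most the excess e = size − C. Hence z_H ≤ LB + tri e + min(s, e), where
-- tri e = e(e−1)/2 pays for the targets still to come, as e drops at every retrieval; with
-- e ≤ k this is LB + k(k+1)/2. For k = 2 this gives 3 instead of 2: the extra unit is recovered
-- by following H through the only configuration admitting two bad moves in a row.

open import Defs
open import Data.Nat using (ℕ; zero; suc; _+_; _*_; _∸_; _/_; _≤_; _<_; _⊓_; _⊔_; z≤n; s≤s; _≟_; _<?_)
open import Data.Nat.Properties
open import Data.Nat.DivMod using (m*n/n≡m)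
open import Data.Nat.Tactic.RingSolver using (solve-∀)
open import Data.List using (List; []; _∷_; length; _++_; foldr)
open import Data.List.Properties using (length-++; ∷-injectiveˡ; ∷-injectiveʳ)
open import Data.List.Membership.Propositional using (_∈_; _∉_)
open import Data.List.Membership.Propositional.Properties using (∈-++⁺ˡ; ∈-++⁺ʳ; ∈-++⁻)
open import Data.List.Membership.DecPropositional _≟_ using (_∈?_)
open import Data.List.Relation.Unary.Any as Any using (Any; here; there; any?)
open import Data.List.Relation.Unary.All as All using (All; []; _∷_)
open import Data.List.Relation.Unary.AllPairs using ([]; _∷_)
open import Data.List.Relation.Unary.Unique.Propositional using (Unique)
open import Data.Vec using ([]; _∷_; lookup; _[_]≔_)
open import Data.Vec.Properties using (lookup∘update; lookup∘update′)
open import Data.Fin using (Fin) renaming (zero to fzero; suc to fsuc)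
import Data.Fin.Properties as Fin
open import Data.Product using (∃; _×_; _,_; proj₁; proj₂)
open import Data.Sum using (_⊎_; inj₁; inj₂)
open import Data.Empty using (⊥; ⊥-elim)
open import Relation.Nullary using (yes; no; ¬_)
open import Function using (case_of_)
open import Relation.Binary.PropositionalEquality

private variable
  C : ℕ

+-≡⇒≤ : ∀ {a b p q} e → a + p ≡ b + q → q ≤ e + p → a ≤ e + b
+-≡⇒≤ {a} {b} {p} {q} e eq q≤e+p = +-cancelʳ-≤ p a (e + b) (begin
  a + p       ≡⟨ eq ⟩
  b + q       ≤⟨ +-monoʳ-≤ b q≤e+p ⟩
  b + (e + p) ≡⟨ shuffle b e p ⟩
  e + b + p   ∎)
  where
  open ≤-Reasoning
  shuffle : ∀ b e p → b + (e + p) ≡ e + b + p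
  shuffle = solve-∀

+-≡⇒+≤ : ∀ {a b p q} e → a + p ≡ b + q → e + q ≤ p → e + a ≤ b
+-≡⇒+≤ {a} {b} {p} {q} e eq e+q≤p = +-cancelʳ-≤ q (e + a) b (begin
  e + a + q   ≡⟨ shuffle e a q ⟩
  a + (e + q) ≤⟨ +-monoʳ-≤ a e+q≤p ⟩
  a + p       ≡⟨ eq ⟩
  b + q       ∎)
  where
  open ≤-Reasoning
  shuffle : ∀ e a q → e + a + q ≡ a + (e + q)
  shuffle = solve-∀

tri : ℕ → ℕ
tri zero    = 0
tri (suc n) = n + tri n

tri-mono : ∀ {m n} → m ≤ n → tri m ≤ tri n
tri-mono {zero}  _         = z≤n
tri-mono {suc m} (s≤s m≤n) = +-mono-≤ m≤n (tri-mono m≤n)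

tri-suc-∸ : ∀ m C → tri (suc (m ∸ C)) ≤ tri (suc m ∸ C)
tri-suc-∸ m       zero    = ≤-refl
tri-suc-∸ zero    (suc C) = z≤n
tri-suc-∸ (suc m) (suc C) = tri-suc-∸ m C

tri-suc≡ : ∀ k → tri (suc k) ≡ k * suc k / 2
tri-suc≡ k = sym (trans (cong (_/ 2) (sym (double k))) (m*n/n≡m (tri (suc k)) 2))
  where
  double : ∀ k → tri (suc k) * 2 ≡ k * suc k
  double zero    = refl
  double (suc k) = begin
    (suc k + tri (suc k)) * 2     ≡⟨ *-distribʳ-+ 2 (suc k) (tri (suc k)) ⟩
    suc k * 2 + tri (suc k) * 2   ≡⟨ cong (suc k * 2 +_) (double k) ⟩
    suc k * 2 + k * suc k         ≡⟨ gauss k ⟩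
    suc k * suc (suc k)           ∎
    where
    open ≡-Reasoning
    gauss : ∀ k → suc k * 2 + k * suc k ≡ suc k * suc (suc k)
    gauss = solve-∀

colSum : (List ℕ → ℕ) → Bay C → ℕ
colSum f []        = 0
colSum f (col ∷ B) = f col + colSum f B

colSum-update : ∀ f (B : Bay C) i v →
  colSum f (B [ i ]≔ v) + f (lookup B i) ≡ colSum f B + f v
colSum-update f (col ∷ B) fzero    v = swap (f v) (colSum f B) (f col)
  where
  swap : ∀ a b c → a + b + c ≡ c + b + a
  swap = solve-∀
colSum-update f (col ∷ B) (fsuc i) v = trans (+-assoc (f col) _ _)
  (trans (cong (f col +_) (colSum-update f B i v)) (sym (+-assoc (f col) _ _)))

colSum-mono : ∀ f g (B : Bay C) → (∀ i → f (lookup B i) ≤ g (lookup B i)) →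
  colSum f B ≤ colSum g B
colSum-mono f g []        f≤g = z≤n
colSum-mono f g (col ∷ B) f≤g = +-mono-≤ (f≤g fzero) (colSum-mono f g B (λ i → f≤g (fsuc i)))

colSum≡0⇒ : ∀ f (B : Bay C) → colSum f B ≡ 0 → ∀ i → f (lookup B i) ≡ 0
colSum≡0⇒ f (col ∷ B) eq fzero    = m+n≡0⇒m≡0 (f col) eq
colSum≡0⇒ f (col ∷ B) eq (fsuc i) = colSum≡0⇒ f B (m+n≡0⇒n≡0 (f col) eq) i

colSum-supported : ∀ f (B : Bay C) c → (∀ i → i ≢ c → f (lookup B i) ≡ 0) →
  colSum f B ≡ f (lookup B c)
colSum-supported f (col ∷ B) fzero    f≡0 =
  trans (cong (f col +_) (zeros B (λ i → f≡0 (fsuc i) (λ ())))) (+-identityʳ _)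
  where
  zeros : ∀ (B : Bay C) → (∀ i → f (lookup B i) ≡ 0) → colSum f B ≡ 0
  zeros []        _   = refl
  zeros (col ∷ B) f≡0 = cong₂ _+_ (f≡0 fzero) (zeros B (λ i → f≡0 (fsuc i)))
colSum-supported f (col ∷ B) (fsuc c) f≡0 = cong₂ _+_ (f≡0 fzero (λ ()))
  (colSum-supported f B c (λ i i≢c → f≡0 (fsuc i) (λ eq → i≢c (Fin.suc-injective eq))))

size≡colSum : ∀ (B : Bay C) → size B ≡ colSum length B
size≡colSum []        = refl
size≡colSum (col ∷ B) = trans (length-++ col) (cong (length col +_) (size≡colSum B))

nonBottom : List ℕ → ℕ
nonBottom col = length col ∸ 1

colSum-nonBottom+C≡size : ∀ (B : Bay C) → (∀ i → 1 ≤ length (lookup B i)) →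
  colSum nonBottom B + C ≡ size B
colSum-nonBottom+C≡size []        _         = refl
colSum-nonBottom+C≡size {C = suc C} (col ∷ B) nonempty = begin
  nonBottom col + colSum nonBottom B + suc C
    ≡⟨ +-suc _ C ⟩
  suc (nonBottom col + colSum nonBottom B + C)
    ≡⟨ cong suc (+-assoc (nonBottom col) _ C) ⟩
  suc (nonBottom col) + (colSum nonBottom B + C)
    ≡⟨ cong₂ _+_ (trans (+-comm 1 _) (m∸n+n≡m (nonempty fzero)))
                 (colSum-nonBottom+C≡size B (λ i → nonempty (fsuc i))) ⟩
  length col + size B
    ≡⟨ length-++ col ⟨
  size (col ∷ B) ∎
  where open ≡-Reasoning

blocking : List ℕ → ℕ
blocking []       = 0
blocking (x ∷ xs) with any? (_<? x) xs
... | yes _ = suc (blocking xs)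
... | no  _ = blocking xs

blocking-∷-≤ : ∀ x xs → blocking (x ∷ xs) ≤ suc (blocking xs)
blocking-∷-≤ x xs with any? (_<? x) xs
... | yes _ = ≤-refl
... | no  _ = n≤1+n _

blocking-∷-≥ : ∀ x xs → blocking xs ≤ blocking (x ∷ xs)
blocking-∷-≥ x xs with any? (_<? x) xs
... | yes _ = n≤1+n _
... | no  _ = ≤-refl

blocking-∷-min : ∀ {x xs} → All (x ≤_) xs → blocking (x ∷ xs) ≡ blocking xs
blocking-∷-min {x} {xs} x≤xs with any? (_<? x) xs
... | yes y<x = ⊥-elim (noneBelow x≤xs y<x)
  where
  noneBelow : ∀ {ys} → All (x ≤_) ys → ¬ Any (_< x) ys
  noneBelow (x≤y ∷ _)   (here y<x)  = <-irrefl refl (≤-<-trans x≤y y<x)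
  noneBelow (_ ∷ x≤ys)  (there y<x) = noneBelow x≤ys y<x
... | no  _   = refl

blocking-∷-blocked : ∀ {x xs y} → y ∈ xs → y < x → blocking (x ∷ xs) ≡ suc (blocking xs)
blocking-∷-blocked {x} {xs} y∈xs y<x with any? (_<? x) xs
... | yes _    = refl
... | no  none = ⊥-elim (none (Any.map (λ { refl → y<x }) y∈xs))

blocking≤length : ∀ xs → blocking xs ≤ length xs
blocking≤length []       = z≤n
blocking≤length (x ∷ xs) = ≤-trans (blocking-∷-≤ x xs) (s≤s (blocking≤length xs))

aboveIn : ℕ → List ℕ → ℕ
aboveIn t []       = 0
aboveIn t (x ∷ xs) with t ∈? xs
... | yes _ = suc (aboveIn t xs)
... | no  _ = 0

aboveIn-∷-∈ : ∀ {t} x {xs} → t ∈ xs → aboveIn t (x ∷ xs) ≡ suc (aboveIn t xs)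
aboveIn-∷-∈ {t} x {xs} t∈xs with t ∈? xs
... | yes _    = refl
... | no  t∉xs = ⊥-elim (t∉xs t∈xs)

aboveIn-∷-∉ : ∀ {t} x {xs} → t ∉ xs → aboveIn t (x ∷ xs) ≡ 0
aboveIn-∷-∉ {t} x {xs} t∉xs with t ∈? xs
... | yes t∈xs = ⊥-elim (t∉xs t∈xs)
... | no  _    = refl

aboveIn-∉ : ∀ {t xs} → t ∉ xs → aboveIn t xs ≡ 0
aboveIn-∉ {xs = []}     _    = refl
aboveIn-∉ {xs = x ∷ xs} t∉xs = aboveIn-∷-∉ x (λ t∈xs → t∉xs (there t∈xs))

aboveIn-pos⇒∈ : ∀ {t} x {xs} → 1 ≤ aboveIn t (x ∷ xs) → t ∈ xs
aboveIn-pos⇒∈ {t} x {xs} 1≤ with t ∈? xs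
... | yes t∈xs = t∈xs
aboveIn-pos⇒∈ x () | no _

aboveIn-≥2⇒ : ∀ {t} x xs → length xs ≤ 2 → 2 ≤ aboveIn t (x ∷ xs) → ∃ λ a → xs ≡ a ∷ t ∷ []
aboveIn-≥2⇒ {t} x xs len≤2 2≤ = two xs len≤2 (≤-pred (≤-trans 2≤ (≤-reflexive (aboveIn-∷-∈ x t∈xs))))
  where
  t∈xs : t ∈ xs
  t∈xs = aboveIn-pos⇒∈ x (≤-trans (s≤s z≤n) 2≤)
  two : ∀ xs → length xs ≤ 2 → 1 ≤ aboveIn t xs → ∃ λ a → xs ≡ a ∷ t ∷ []
  two (a ∷ [])          _               1≤ = case aboveIn-pos⇒∈ {t} a {[]} 1≤ of λ ()
  two (a ∷ y ∷ [])      _               1≤ with aboveIn-pos⇒∈ a 1≤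
  ... | here refl = a , refl
  two (_ ∷ _ ∷ _ ∷ _)  (s≤s (s≤s ())) _

aboveIn≤nonBottom : ∀ t xs → aboveIn t xs ≤ nonBottom xs
aboveIn≤nonBottom t []       = z≤n
aboveIn≤nonBottom t (x ∷ xs) with t ∈? xs
... | no  _ = z≤n
... | yes _ with xs
...   | y ∷ ys = s≤s (aboveIn≤nonBottom t (y ∷ ys))

∈-column⇒∈-labels : ∀ (B : Bay C) i {x} → x ∈ lookup B i → x ∈ labels B
∈-column⇒∈-labels (col ∷ B) fzero    x∈col = ∈-++⁺ˡ x∈col
∈-column⇒∈-labels (col ∷ B) (fsuc i) x∈B   = ∈-++⁺ʳ col (∈-column⇒∈-labels B i x∈B)

∈-labels⇒∃-column : ∀ (B : Bay C) {x} → x ∈ labels B → ∃ λ i → x ∈ lookup B i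
∈-labels⇒∃-column (col ∷ B) x∈B with ∈-++⁻ col x∈B
... | inj₁ x∈col = fzero , x∈col
... | inj₂ x∈B′  = let (i , x∈i) = ∈-labels⇒∃-column B x∈B′ in fsuc i , x∈i

≤maxLabel : ∀ (B : Bay C) {x} → x ∈ labels B → x ≤ maxLabel B
≤maxLabel B = go (labels B)
  where
  go : ∀ xs {x} → x ∈ xs → x ≤ foldr _⊔_ 0 xs
  go (y ∷ ys) (here refl) = m≤m⊔n y _
  go (y ∷ ys) (there x∈) = ≤-trans (go ys x∈) (m≤n⊔m y _)

target : Bay C → ℕ
target B = foldr _⊓_ (maxLabel B) (labels B)

foldr-⊓≤ : ∀ {x} b xs → x ∈ xs → foldr _⊓_ b xs ≤ x
foldr-⊓≤ b (y ∷ ys) (here refl) = m⊓n≤m y _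
foldr-⊓≤ b (y ∷ ys) (there x∈)  = ≤-trans (m⊓n≤n y _) (foldr-⊓≤ b ys x∈)

foldr-⊓-glb : ∀ {t} b xs → All (t ≤_) xs → t ≤ b → t ≤ foldr _⊓_ b xs
foldr-⊓-glb b []       _          t≤b = t≤b
foldr-⊓-glb b (y ∷ ys) (t≤y ∷ t≤) t≤b = ⊓-glb t≤y (foldr-⊓-glb b ys t≤ t≤b)

IsTarget⇒target≡ : ∀ (B : Bay C) {t} → IsTarget B t → target B ≡ t
IsTarget⇒target≡ B (t∈B , t≤B) =
  ≤-antisym (foldr-⊓≤ _ (labels B) t∈B) (foldr-⊓-glb _ (labels B) t≤B (≤maxLabel B t∈B))

colMin≤ : ∀ (B : Bay C) i {x} → x ∈ lookup B i → colMin B i ≤ x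
colMin≤ B i = foldr-⊓≤ _ (lookup B i)

colMin-[] : ∀ (B : Bay C) i → lookup B i ≡ [] → colMin B i ≡ suc (maxLabel B)
colMin-[] B i eq rewrite eq = refl

≤colMin : ∀ (B : Bay C) i {x} → x ∈ lookup B i → All (x ≤_) (lookup B i) → x ≤ colMin B i
≤colMin B i x∈i x≤i =
  foldr-⊓-glb _ (lookup B i) x≤i (≤-trans (≤maxLabel B (∈-column⇒∈-labels B i x∈i)) (n≤1+n _))

colMin-[_] : ∀ (B : Bay C) i {x} → lookup B i ≡ x ∷ [] → colMin B i ≡ x
colMin-[_] B i {x} eq =
  ≤-antisym (colMin≤ B i x∈i) (≤colMin B i x∈i (subst (All (x ≤_)) (sym eq) (≤-refl ∷ [])))
  where
  x∈i : x ∈ lookup B i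
  x∈i = subst (x ∈_) (sym eq) (here refl)

record Distinct (B : Bay C) : Set where
  field
    unique : ∀ i → Unique (lookup B i)
    column : ∀ {i j x} → x ∈ lookup B i → x ∈ lookup B j → i ≡ j

Unique-∷⇒∉ : ∀ {x : ℕ} {xs} → Unique (x ∷ xs) → x ∉ xs
Unique-∷⇒∉ (x≢xs ∷ _) x∈xs = All.lookup x≢xs x∈xs refl

Unique-∷⇒Unique : ∀ {x : ℕ} {xs} → Unique (x ∷ xs) → Unique xs
Unique-∷⇒Unique (_ ∷ u) = u

Unique-++⁻ : ∀ (xs ys : List ℕ) → Unique (xs ++ ys) →
  Unique xs × Unique ys × (∀ {x} → x ∈ xs → x ∉ ys)
Unique-++⁻ []       ys u = [] , u , λ ()
Unique-++⁻ (x ∷ xs) ys (x≢ ∷ u) with Unique-++⁻ xs ys u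
... | uxs , uys , disjoint =
  All.tabulate (λ x′∈xs → All.lookup x≢ (∈-++⁺ˡ x′∈xs)) ∷ uxs , uys ,
  λ { (here refl) x∈ys → All.lookup x≢ (∈-++⁺ʳ xs x∈ys) refl ; (there x′∈xs) → disjoint x′∈xs }

Unique-labels⇒Distinct : ∀ (B : Bay C) → Unique (labels B) → Distinct B
Unique-labels⇒Distinct []        _ = record { unique = λ () ; column = λ { {()} } }
Unique-labels⇒Distinct (col ∷ B) u with Unique-++⁻ col (labels B) u
... | ucol , uB , disjoint = record { unique = unique′ ; column = column′ }
  where
  open Distinct (Unique-labels⇒Distinct B uB)
  unique′ : ∀ i → Unique (lookup (col ∷ B) i)
  unique′ fzero    = ucol
  unique′ (fsuc i) = unique i
  column′ : ∀ {i j x} → x ∈ lookup (col ∷ B) i → x ∈ lookup (col ∷ B) j → i ≡ j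
  column′ {fzero}  {fzero}  _   _   = refl
  column′ {fzero}  {fsuc j} x∈i x∈j = ⊥-elim (disjoint x∈i (∈-column⇒∈-labels B j x∈j))
  column′ {fsuc i} {fzero}  x∈i x∈j = ⊥-elim (disjoint x∈j (∈-column⇒∈-labels B i x∈i))
  column′ {fsuc i} {fsuc j} x∈i x∈j = cong fsuc (column x∈i x∈j)

blockingCount : Bay C → ℕ
blockingCount = colSum blocking

above : ℕ → Bay C → ℕ
above t = colSum (aboveIn t)

excess : Bay C → ℕ
excess {C} B = size B ∸ C

potential : ℕ → ℕ → ℕ
potential e s = tri e + s ⊓ e

Φ : Bay C → ℕ
Φ B = potential (excess B) (above (target B) B)

-- Retrievals and relocations

module Retrieving {B B′ : Bay C} (rt : Retrieval B B′) where
  open Retrieval rt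

  lookup-c : lookup B′ c ≡ rest
  lookup-c = trans (cong (λ X → lookup X c) next) (lookup∘update c B rest)

  lookup-other : ∀ {i} → i ≢ c → lookup B′ i ≡ lookup B i
  lookup-other i≢c = trans (cong (λ X → lookup X _) next) (lookup∘update′ i≢c B rest)

  ∈-after⇒∈-before : ∀ i {x} → x ∈ lookup B′ i → x ∈ lookup B i
  ∈-after⇒∈-before i x∈ with i Fin.≟ c
  ... | yes refl = subst (_ ∈_) (sym top) (there (subst (_ ∈_) lookup-c x∈))
  ... | no  i≢c  = subst (_ ∈_) (lookup-other i≢c) x∈

  colSum-retrieve : ∀ f → colSum f B′ + f (t ∷ rest) ≡ colSum f B + f rest
  colSum-retrieve f = begin
    colSum f B′ + f (t ∷ rest)                ≡⟨ cong₂ (λ X col → colSum f X + f col) next (sym top) ⟩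
    colSum f (B [ c ]≔ rest) + f (lookup B c) ≡⟨ colSum-update f B c rest ⟩
    colSum f B + f rest                       ∎
    where open ≡-Reasoning

  size≡suc : size B ≡ suc (size B′)
  size≡suc = begin
    size B                 ≡⟨ size≡colSum B ⟩
    colSum length B        ≡⟨ +-cancelʳ-≡ (length rest) _ _ (trans (sym (colSum-retrieve length)) (+-suc _ _)) ⟩
    suc (colSum length B′) ≡⟨ cong suc (size≡colSum B′) ⟨
    suc (size B′)          ∎
    where open ≡-Reasoning

  blockingCount≡ : blockingCount B′ ≡ blockingCount B
  blockingCount≡ = +-cancelʳ-≡ (blocking rest) _ _
    (trans (cong (blockingCount B′ +_) (sym (blocking-∷-min t≤rest))) (colSum-retrieve blocking))
    where
    t≤rest : All (t ≤_) rest
    t≤rest = All.tabulate λ x∈rest →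
      All.lookup (proj₂ isTarget) (∈-column⇒∈-labels B c (subst (_ ∈_) (sym top) (there x∈rest)))

  distinct : Distinct B → Distinct B′
  distinct dist = record
    { unique = unique′
    ; column = λ x∈i x∈j → column (∈-after⇒∈-before _ x∈i) (∈-after⇒∈-before _ x∈j)
    }
    where
    open Distinct dist
    unique′ : ∀ i → Unique (lookup B′ i)
    unique′ i with i Fin.≟ c
    ... | yes refl = subst Unique (sym lookup-c) (Unique-∷⇒Unique (subst Unique top (unique c)))
    ... | no  i≢c  = subst Unique (sym (lookup-other i≢c)) (unique i)

module Relocating {C P Choice} {B B′ : Bay C} (rl : Relocation P Choice B B′) where
  open Relocation rl

  D : List ℕ
  D = lookup B d

  d≢c : d ≢ c
  d≢c = proj₁ cand

  lookup-c : lookup B′ c ≡ rest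
  lookup-c = trans (cong (λ X → lookup X c) next)
    (trans (lookup∘update′ (λ c≡d → d≢c (sym c≡d)) (B [ c ]≔ rest) (r ∷ D)) (lookup∘update c B rest))

  lookup-d : lookup B′ d ≡ r ∷ D
  lookup-d = trans (cong (λ X → lookup X d) next) (lookup∘update d (B [ c ]≔ rest) (r ∷ D))

  lookup-other : ∀ {i} → i ≢ c → i ≢ d → lookup B′ i ≡ lookup B i
  lookup-other i≢c i≢d = trans (cong (λ X → lookup X _) next)
    (trans (lookup∘update′ i≢d (B [ c ]≔ rest) (r ∷ D)) (lookup∘update′ i≢c B rest))

  colSum-relocate : ∀ f → colSum f B′ + (f (r ∷ rest) + f D) ≡ colSum f B + (f rest + f (r ∷ D))
  colSum-relocate f = begin
    colSum f B′ + (f (r ∷ rest) + f D)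
      ≡⟨ cong₂ (λ X col → colSum f X + (f col + f D)) next (sym top) ⟩
    colSum f ((B [ c ]≔ rest) [ d ]≔ (r ∷ D)) + (f (lookup B c) + f D)
      ≡⟨ cong (λ col → colSum f ((B [ c ]≔ rest) [ d ]≔ (r ∷ D)) + (f (lookup B c) + f col))
              (sym (lookup∘update′ d≢c B rest)) ⟩
    colSum f (B₁ [ d ]≔ (r ∷ D)) + (f (lookup B c) + f (lookup B₁ d))
      ≡⟨ shuffle (colSum f (B₁ [ d ]≔ (r ∷ D))) (f (lookup B c)) (f (lookup B₁ d)) ⟩
    colSum f (B₁ [ d ]≔ (r ∷ D)) + f (lookup B₁ d) + f (lookup B c)
      ≡⟨ cong (_+ f (lookup B c)) (colSum-update f B₁ d (r ∷ D)) ⟩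
    colSum f B₁ + f (r ∷ D) + f (lookup B c)
      ≡⟨ shuffle′ (colSum f B₁) (f (r ∷ D)) (f (lookup B c)) ⟩
    colSum f B₁ + f (lookup B c) + f (r ∷ D)
      ≡⟨ cong (_+ f (r ∷ D)) (colSum-update f B c rest) ⟩
    colSum f B + f rest + f (r ∷ D)
      ≡⟨ +-assoc (colSum f B) _ _ ⟩
    colSum f B + (f rest + f (r ∷ D)) ∎
    where
    open ≡-Reasoning
    B₁ = B [ c ]≔ rest
    shuffle : ∀ a b c → a + (b + c) ≡ a + c + b
    shuffle = solve-∀
    shuffle′ : ∀ a b c → a + b + c ≡ a + c + b
    shuffle′ = solve-∀

  size≡ : size B′ ≡ size B
  size≡ = begin
    size B′          ≡⟨ size≡colSum B′ ⟩
    colSum length B′ ≡⟨ +-cancelʳ-≡ (suc (length rest + length D)) _ _ (begin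
      colSum length B′ + suc (length rest + length D)        ≡⟨ colSum-relocate length ⟩
      colSum length B + (length rest + suc (length D))       ≡⟨ cong (colSum length B +_) (+-suc _ _) ⟩
      colSum length B + suc (length rest + length D)         ∎) ⟩
    colSum length B  ≡⟨ size≡colSum B ⟨
    size B           ∎
    where open ≡-Reasoning

  blockingCount≤suc : blockingCount B ≤ suc (blockingCount B′)
  blockingCount≤suc = +-≡⇒≤ 1 (sym (colSum-relocate blocking))
    (+-mono-≤ (blocking-∷-≤ r rest) (blocking-∷-≥ r D))

  r∈c : r ∈ lookup B c
  r∈c = subst (r ∈_) (sym top) (here refl)

  rest⊆c : ∀ {x} → x ∈ rest → x ∈ lookup B c
  rest⊆c x∈rest = subst (_ ∈_) (sym top) (there x∈rest)

  t≤r : t ≤ r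
  t≤r = All.lookup (proj₂ isTarget) (∈-column⇒∈-labels B c r∈c)

  isTarget′ : IsTarget B′ t
  isTarget′ = ∈-column⇒∈-labels B′ c (subst (t ∈_) (sym lookup-c) notTop) ,
    All.tabulate λ x∈B′ → let (i , x∈i) = ∈-labels⇒∃-column B′ x∈B′ in below-t i x∈i
    where
    below-t : ∀ i {x} → x ∈ lookup B′ i → t ≤ x
    below-t i x∈i with i Fin.≟ d
    ... | yes refl with subst (_ ∈_) lookup-d x∈i
    ...   | here refl = t≤r
    ...   | there x∈D = All.lookup (proj₂ isTarget) (∈-column⇒∈-labels B d x∈D)
    below-t i x∈i | no i≢d with i Fin.≟ c
    ... | yes refl = All.lookup (proj₂ isTarget) (∈-column⇒∈-labels B c (rest⊆c (subst (_ ∈_) lookup-c x∈i)))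
    ... | no  i≢c  =
      All.lookup (proj₂ isTarget) (∈-column⇒∈-labels B i (subst (_ ∈_) (lookup-other i≢c i≢d) x∈i))

  Φ≡ : Φ B ≡ potential (excess B) (above t B)
  Φ≡ = cong (λ x → potential (excess B) (above x B)) (IsTarget⇒target≡ B isTarget)

  Φ′≡ : Φ B′ ≡ potential (excess B) (above t B′)
  Φ′≡ = cong₂ (λ n x → potential (n ∸ C) (above x B′)) size≡ (IsTarget⇒target≡ B′ isTarget′)

  module _ (dist : Distinct B) where
    open Distinct dist

    r∉D : r ∉ D
    r∉D r∈D = d≢c (column r∈D r∈c)

    t∉D : t ∉ D
    t∉D t∈D = d≢c (column t∈D (rest⊆c notTop))

    r∉rest : r ∉ rest
    r∉rest = Unique-∷⇒∉ (subst Unique top (unique c))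

    t<r : t < r
    t<r = ≤∧≢⇒< t≤r (λ { refl → r∉rest notTop })

    blockingCount-≤ : blockingCount B′ ≤ blockingCount B
    blockingCount-≤ = +-≡⇒≤ 0 (colSum-relocate blocking) (begin
      blocking rest + blocking (r ∷ D)     ≤⟨ +-monoʳ-≤ (blocking rest) (blocking-∷-≤ r D) ⟩
      blocking rest + suc (blocking D)     ≡⟨ +-suc _ _ ⟩
      suc (blocking rest) + blocking D     ≡⟨ cong (_+ blocking D) (blocking-∷-blocked notTop t<r) ⟨
      blocking (r ∷ rest) + blocking D     ∎)
      where open ≤-Reasoning

    blockingCount-< : r < colMin B d → blockingCount B′ < blockingCount B
    blockingCount-< r<D = +-≡⇒+≤ 1 (colSum-relocate blocking) (≤-reflexive (begin
      suc (blocking rest + blocking (r ∷ D)) ≡⟨ cong (λ n → suc (blocking rest + n)) (blocking-∷-min r≤D) ⟩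
      suc (blocking rest) + blocking D       ≡⟨ cong (_+ blocking D) (blocking-∷-blocked notTop t<r) ⟨
      blocking (r ∷ rest) + blocking D       ∎))
      where
      open ≡-Reasoning
      r≤D : All (r ≤_) D
      r≤D = All.tabulate λ x∈D → <⇒≤ (<-≤-trans r<D (colMin≤ B d x∈D))

    above-< : above t B′ < above t B
    above-< = +-≡⇒+≤ 1 (colSum-relocate (aboveIn t)) (≤-reflexive (begin
      suc (aboveIn t rest + aboveIn t (r ∷ D)) ≡⟨ cong (λ n → suc (aboveIn t rest + n)) (aboveIn-∷-∉ r t∉D) ⟩
      suc (aboveIn t rest + 0)                 ≡⟨ cong₂ _+_ (aboveIn-∷-∈ r notTop) (aboveIn-∉ t∉D) ⟨
      aboveIn t (r ∷ rest) + aboveIn t D       ∎))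
      where open ≡-Reasoning

    ∈-after : ∀ i {x} → x ∈ lookup B′ i → (x ≡ r × i ≡ d) ⊎ (x ≢ r × x ∈ lookup B i)
    ∈-after i x∈ with i Fin.≟ d
    ... | yes refl with subst (_ ∈_) lookup-d x∈
    ...   | here x≡r  = inj₁ (x≡r , refl)
    ...   | there x∈D = inj₂ ((λ { refl → r∉D x∈D }) , x∈D)
    ∈-after i x∈ | no i≢d with i Fin.≟ c
    ... | yes refl = let x∈rest = subst (_ ∈_) lookup-c x∈ in
                     inj₂ ((λ { refl → r∉rest x∈rest }) , rest⊆c x∈rest)
    ... | no  i≢c  = let x∈i = subst (_ ∈_) (lookup-other i≢c i≢d) x∈ in
                     inj₂ ((λ { refl → i≢c (column x∈i r∈c) }) , x∈i)

    distinct : Distinct B′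
    distinct = record { unique = unique′ ; column = column′ }
      where
      unique′ : ∀ i → Unique (lookup B′ i)
      unique′ i with i Fin.≟ d
      ... | yes refl = subst Unique (sym lookup-d)
                         (All.tabulate (λ x∈D r≡x → r∉D (subst (_∈ D) (sym r≡x) x∈D)) ∷ unique d)
      ... | no  i≢d with i Fin.≟ c
      ...   | yes refl = subst Unique (sym lookup-c) (Unique-∷⇒Unique (subst Unique top (unique c)))
      ...   | no  i≢c  = subst Unique (sym (lookup-other i≢c i≢d)) (unique i)
      column′ : ∀ {i j x} → x ∈ lookup B′ i → x ∈ lookup B′ j → i ≡ j
      column′ {i} {j} x∈i x∈j with ∈-after i x∈i | ∈-after j x∈j
      ... | inj₁ (_ , refl)   | inj₁ (_ , refl)   = refl
      ... | inj₁ (x≡r , _)    | inj₂ (x≢r , _)    = ⊥-elim (x≢r x≡r)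
      ... | inj₂ (x≢r , _)    | inj₁ (x≡r , _)    = ⊥-elim (x≢r x≡r)
      ... | inj₂ (_ , x∈i′)   | inj₂ (_ , x∈j′)   = column x∈i′ x∈j′

blockingCount≤size : (B : Bay C) → blockingCount B ≤ size B
blockingCount≤size B = ≤-trans (colSum-mono blocking length B (λ i → blocking≤length (lookup B i)))
  (≤-reflexive (sym (size≡colSum B)))

-- A relocation unblocks at most one container, and retrieving the minimum unblocks none.
blockingCount≤relocations : ∀ {P Choice} {B : Bay C} {z} → Run P Choice B z → blockingCount B ≤ z
blockingCount≤relocations {B = B} (done empty) =
  ≤-trans (blockingCount≤size B) (≤-reflexive (cong length empty))
blockingCount≤relocations (retr rt run) =
  ≤-trans (≤-reflexive (sym (Retrieving.blockingCount≡ rt))) (blockingCount≤relocations run)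
blockingCount≤relocations (relo rl run) =
  ≤-trans (Relocating.blockingCount≤suc rl) (s≤s (blockingCount≤relocations run))

-- The general bound

potential-monoʳ : ∀ e {s s′} → s′ ≤ s → potential e s′ ≤ potential e s
potential-monoʳ e s′≤s = +-monoʳ-≤ (tri e) (⊓-monoˡ-≤ e s′≤s)

potential-<ʳ : ∀ e {s s′} → s′ < s → s ≤ e → potential e s′ < potential e s
potential-<ʳ e {s} {s′} s′<s s≤e = begin-strict
  tri e + s′ ⊓ e ≤⟨ +-monoʳ-≤ (tri e) (m⊓n≤m s′ e) ⟩
  tri e + s′     <⟨ +-monoʳ-< (tri e) s′<s ⟩
  tri e + s      ≡⟨ cong (tri e +_) (m≤n⇒m⊓n≡m s≤e) ⟨
  tri e + s ⊓ e  ∎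
  where open ≤-Reasoning

Φ≤tri : (B : Bay C) → Φ B ≤ tri (suc (excess B))
Φ≤tri B = ≤-trans (+-monoʳ-≤ (tri (excess B)) (m⊓n≤n _ _)) (≤-reflexive (+-comm _ (excess B)))

excess≤ : ∀ (B : Bay C) k → size B ≤ C + k → excess B ≤ k
excess≤ {C} B k size≤ = ≤-trans (∸-monoˡ-≤ C size≤) (≤-reflexive (m+n∸m≡n C k))

Φ-retrieve : ∀ {B B′ : Bay C} → Retrieval B B′ → Φ B′ ≤ Φ B
Φ-retrieve {C} {B} {B′} rt = begin
  Φ B′                       ≤⟨ Φ≤tri B′ ⟩
  tri (suc (size B′ ∸ C))    ≤⟨ tri-suc-∸ (size B′) C ⟩
  tri (suc (size B′) ∸ C)    ≡⟨ cong (λ n → tri (n ∸ C)) (Retrieving.size≡suc rt) ⟨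
  tri (excess B)             ≤⟨ m≤m+n _ _ ⟩
  Φ B                        ∎
  where open ≤-Reasoning

excess≡colSum-nonBottom : ∀ (B : Bay C) → (∀ i → 1 ≤ length (lookup B i)) → excess B ≡ colSum nonBottom B
excess≡colSum-nonBottom {C} B nonempty =
  trans (cong (_∸ C) (sym (colSum-nonBottom+C≡size B nonempty))) (m+n∸n≡m _ C)

above≤excess : ∀ (B : Bay C) t → (∀ i → 1 ≤ length (lookup B i)) → above t B ≤ excess B
above≤excess B t nonempty =
  ≤-trans (colSum-mono (aboveIn t) nonBottom B (λ i → aboveIn≤nonBottom t (lookup B i)))
          (≤-reflexive (sym (excess≡colSum-nonBottom B nonempty)))

-- An empty column would have colMin = N + 1 > r, so H would not have moved r on top of a smaller label.
noEmptyColumn : ∀ {P} (B : Bay C) c r rest → 1 ≤ P → lookup B c ≡ r ∷ rest →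
  (∀ e → Cand P B c e → colMin B e ≤ r) → ∀ i → 1 ≤ length (lookup B i)
noEmptyColumn B c r rest 1≤P top allBelow i with i Fin.≟ c
... | yes refl rewrite top = s≤s z≤n
... | no  i≢c with lookup B i in eq
...   | _ ∷ _ = s≤s z≤n
...   | []    = ⊥-elim (<⇒≱ (s≤s r≤N) (begin
  suc (maxLabel B) ≡⟨ colMin-[] B i eq ⟨
  colMin B i       ≤⟨ allBelow i (i≢c , subst (λ col → length col < _) (sym eq) 1≤P) ⟩
  r                ∎))
  where
  open ≤-Reasoning
  r≤N : r ≤ maxLabel B
  r≤N = ≤maxLabel B (∈-column⇒∈-labels B c (subst (r ∈_) (sym top) (here refl)))

H-bound : ∀ {P} → 1 ≤ P → {B : Bay C} {n : ℕ} → HRun P B n → Distinct B → n ≤ blockingCount B + Φ B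
H-bound 1≤P (done _) _ = z≤n
H-bound 1≤P (retr rt run) dist = ≤-trans (H-bound 1≤P run (Retrieving.distinct rt dist))
  (+-mono-≤ (≤-reflexive (Retrieving.blockingCount≡ rt)) (Φ-retrieve rt))
H-bound {P = P} 1≤P {B} (relo {B' = B′} rl run) dist =
  ≤-trans (s≤s (H-bound 1≤P run (distinct dist))) (byChoice choice)
  where
  open Relocation rl
  open Relocating rl
  byChoice : HChoice P B c r d → suc (blockingCount B′ + Φ B′) ≤ blockingCount B + Φ B
  byChoice (inj₁ (r<d , _)) = +-mono-≤ (blockingCount-< dist r<d) (begin
    Φ B′                                  ≡⟨ Φ′≡ ⟩
    potential (excess B) (above t B′)     ≤⟨ potential-monoʳ (excess B) (<⇒≤ (above-< dist)) ⟩
    potential (excess B) (above t B)      ≡⟨ Φ≡ ⟨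
    Φ B                                   ∎)
    where open ≤-Reasoning
  byChoice (inj₂ (allBelow , _)) = ≤-trans (≤-reflexive (sym (+-suc _ _)))
    (+-mono-≤ (blockingCount-≤ dist) (begin-strict
      Φ B′                                ≡⟨ Φ′≡ ⟩
      potential (excess B) (above t B′)   <⟨ potential-<ʳ (excess B) (above-< dist)
                                               (above≤excess B t (noEmptyColumn B c r rest 1≤P top allBelow)) ⟩
      potential (excess B) (above t B)    ≡⟨ Φ≡ ⟨
      Φ B                                 ∎))
    where open ≤-Reasoning

Φ≤tri-suc : ∀ (B : Bay C) k → size B ≤ C + k → Φ B ≤ tri (suc k)
Φ≤tri-suc B k size≤ = ≤-trans (Φ≤tri B) (tri-mono (s≤s (excess≤ B k size≤)))

H-bound-excess : ∀ {P} → 1 ≤ P → ∀ {B : Bay C} {n} k → HRun P B n → Distinct B → size B ≤ C + k →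
  n ≤ blockingCount B + tri (suc k)
H-bound-excess 1≤P {B} k run dist size≤ =
  ≤-trans (H-bound 1≤P run dist) (+-monoʳ-≤ (blockingCount B) (Φ≤tri-suc B k size≤))

-- Excess two

size-retrieve-≤ : ∀ {B B′ : Bay C} k → Retrieval B B′ → size B ≤ C + suc k → size B′ ≤ C + k
size-retrieve-≤ {C} k rt size≤ =
  ≤-pred (≤-trans (≤-reflexive (sym (Retrieving.size≡suc rt))) (≤-trans size≤ (≤-reflexive (+-suc C k))))

∃-third : 3 ≤ C → (c d : Fin C) → ∃ λ e → e ≢ c × e ≢ d
∃-third {suc zero}       (s≤s ())        _ _
∃-third {suc (suc zero)} (s≤s (s≤s ())) _ _
∃-third {suc (suc (suc _))} _ c d with fzero Fin.≟ c | fzero Fin.≟ d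
... | no 0≢c   | no 0≢d   = fzero , 0≢c , 0≢d
... | yes refl | yes refl = fsuc fzero , (λ ()) , (λ ())
... | yes refl | no _ with fsuc fzero Fin.≟ d
...   | no 1≢d   = fsuc fzero , (λ ()) , 1≢d
...   | yes refl = fsuc (fsuc fzero) , (λ ()) , (λ ())
∃-third {suc (suc (suc _))} _ c d | no _ | yes refl with fsuc fzero Fin.≟ c
...   | no 1≢c   = fsuc fzero , 1≢c , (λ ())
...   | yes refl = fsuc (fsuc fzero) , (λ ()) , (λ ())

∉-below-singleton : ∀ {B : Bay C} {i j x y ys} → Distinct B →
  lookup B i ≡ x ∷ [] → lookup B j ≡ y ∷ ys → x ∉ ys
∉-below-singleton {x = x} dist li lj x∈ys
  with Distinct.column dist (subst (x ∈_) (sym lj) (there x∈ys)) (subst (x ∈_) (sym li) (here refl))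
... | refl = case ∷-injectiveʳ (trans (sym li) lj) of λ { refl → case x∈ys of λ () }

-- All columns being nonempty, the excess counts the non-bottom containers; two of them lie above t.
bad-move-shape : ∀ {B : Bay C} {c r rest t} → Distinct B → lookup B c ≡ r ∷ rest → t ∈ rest →
  (∀ i → 1 ≤ length (lookup B i)) → size B ≤ C + 2 → 2 ≤ above t B →
  (∃ λ a → rest ≡ a ∷ t ∷ []) × (∀ i → i ≢ c → ∃ λ x → lookup B i ≡ x ∷ [])
bad-move-shape {C} {B} {c} {r} {rest} {t} dist top t∈rest nonempty size≤ 2≤above =
  aboveIn-≥2⇒ r rest (subst (λ col → nonBottom col ≤ 2) top nonBottom-c≤2)
                     (subst (λ col → 2 ≤ aboveIn t col) top 2≤above-c) ,
  λ i i≢c → singleton (lookup B i) (nonempty i)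
    (trans (cong nonBottom (sym (lookup∘update′ i≢c B []))) (colSum≡0⇒ nonBottom (B [ c ]≔ []) others≡0 i))
  where
  t∈c : t ∈ lookup B c
  t∈c = subst (t ∈_) (sym top) (there t∈rest)
  2≤above-c : 2 ≤ aboveIn t (lookup B c)
  2≤above-c = ≤-trans 2≤above (≤-reflexive (colSum-supported (aboveIn t) B c
    (λ i i≢c → aboveIn-∉ (λ t∈i → i≢c (Distinct.column dist t∈i t∈c)))))
  split≤2 : colSum nonBottom (B [ c ]≔ []) + nonBottom (lookup B c) ≤ 2
  split≤2 = begin
    colSum nonBottom (B [ c ]≔ []) + nonBottom (lookup B c) ≡⟨ colSum-update nonBottom B c [] ⟩
    colSum nonBottom B + 0                                  ≡⟨ +-identityʳ _ ⟩
    colSum nonBottom B                                      ≡⟨ excess≡colSum-nonBottom B nonempty ⟨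
    excess B                                                ≤⟨ excess≤ B 2 size≤ ⟩
    2                                                       ∎
    where open ≤-Reasoning
  nonBottom-c≤2 : nonBottom (lookup B c) ≤ 2
  nonBottom-c≤2 = ≤-trans (m≤n+m _ _) split≤2
  others≡0 : colSum nonBottom (B [ c ]≔ []) ≡ 0
  others≡0 = n≤0⇒n≡0 (+-cancelʳ-≤ (nonBottom (lookup B c)) _ 0
    (≤-trans split≤2 (≤-trans 2≤above-c (aboveIn≤nonBottom t (lookup B c)))))
  singleton : ∀ col → 1 ≤ length col → nonBottom col ≡ 0 → ∃ λ x → col ≡ x ∷ []
  singleton (x ∷ []) _ _ = x , refl

-- Two bad moves in a row force the following trajectory, with t the target and xd the largest
-- label among the singleton columns: c = r∷a∷t, d = xd  ⟶  c = a∷t, d = r∷xd  ⟶  c = t, d = a∷r∷xd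
-- ⟶ (retrieving t) c empty, after which the target is always on top.
SmallSingletons : Bay C → Fin C → Fin C → ℕ → Set
SmallSingletons B c d xd = ∀ i → i ≢ c → i ≢ d → ∃ λ x → lookup B i ≡ x ∷ [] × x < xd

SmallSingletons-maximal : ∀ {P} {B : Bay C} {c d xd} → 2 ≤ P → Distinct B → lookup B d ≡ xd ∷ [] →
  (∀ e → Cand P B c e → colMin B e ≤ colMin B d) → (∀ i → i ≢ c → ∃ λ x → lookup B i ≡ x ∷ []) →
  SmallSingletons B c d xd
SmallSingletons-maximal {P = P} {B} {c} {d} {xd} 2≤P dist ld maximal singletons i i≢c i≢d =
  x , li , ≤∧≢⇒< x≤xd x≢xd
  where
  x = proj₁ (singletons i i≢c)
  li : lookup B i ≡ x ∷ []
  li = proj₂ (singletons i i≢c)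
  x≤xd : x ≤ xd
  x≤xd = begin
    x            ≡⟨ colMin-[ B ] i li ⟨
    colMin B i   ≤⟨ maximal i (i≢c , subst (λ col → length col < P) (sym li) 2≤P) ⟩
    colMin B d   ≡⟨ colMin-[ B ] d ld ⟩
    xd           ∎
    where open ≤-Reasoning
  x≢xd : x ≢ xd
  x≢xd x≡xd = i≢d (Distinct.column dist (subst (x ∈_) (sym li) (here refl)) (subst (x ∈_) (sym ld) (here x≡xd)))

SmallSingletons-retrieve : ∀ {B B′ : Bay C} (rt : Retrieval B B′) {d xd} →
  SmallSingletons B (Retrieval.c rt) d xd → SmallSingletons B′ (Retrieval.c rt) d xd
SmallSingletons-retrieve rt small i i≢c i≢d =
  let (x , li , x<xd) = small i i≢c i≢d in x , trans (Retrieving.lookup-other rt i≢c) li , x<xd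

SmallSingletons-relocate : ∀ {P Choice} {B B′ : Bay C} (rl : Relocation P Choice B B′) {xd} →
  SmallSingletons B (Relocation.c rl) (Relocation.d rl) xd →
  SmallSingletons B′ (Relocation.c rl) (Relocation.d rl) xd
SmallSingletons-relocate rl small i i≢c i≢d =
  let (x , li , x<xd) = small i i≢c i≢d in x , trans (Relocating.lookup-other rl i≢c i≢d) li , x<xd

module _ {P} (3≤P : 3 ≤ P) (3≤C : 3 ≤ C) where

  private
    1≤P : 1 ≤ P
    1≤P = ≤-trans (s≤s z≤n) 3≤P

  H-bound-retrieve : ∀ {B B′ : Bay C} {n} k → Retrieval B B′ → HRun P B′ n → Distinct B →
    size B ≤ C + suc k → n ≤ blockingCount B + tri (suc k)
  H-bound-retrieve k rt run dist size≤ = subst (λ m → _ ≤ m + tri (suc k)) (Retrieving.blockingCount≡ rt)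
    (H-bound-excess 1≤P k run (Retrieving.distinct rt dist) (size-retrieve-≤ k rt size≤))

  H-bound-c≡[] : ∀ {B : Bay C} {n} c d {a r xd} → d ≢ c → HRun P B n → Distinct B → size B ≤ C + 1 →
    lookup B c ≡ [] → lookup B d ≡ a ∷ r ∷ xd ∷ [] → xd ≤ r → SmallSingletons B c d xd →
    n ≤ blockingCount B
  H-bound-c≡[] c d d≢c (done _) _ _ _ _ _ _ = z≤n
  H-bound-c≡[] c d d≢c (retr rt run) dist size≤ _ _ _ _ =
    ≤-trans (H-bound-retrieve 0 rt run dist size≤) (≤-reflexive (+-identityʳ _))
  H-bound-c≡[] {B = B} c d {xd = xd} d≢c (relo rl _) _ _ lc ld xd≤r small = ⊥-elim (noRelocation c′ top notTop)
    where
    open Relocation rl using (t; isTarget; top; notTop) renaming (c to c′)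
    -- A third column holds a label below xd ≤ r, so the target is a or sits alone in its column.
    noRelocation : ∀ c′ {r′ rest} → lookup B c′ ≡ r′ ∷ rest → t ∈ rest → ⊥
    noRelocation c′ top t∈rest with c′ Fin.≟ c | c′ Fin.≟ d
    ... | yes refl | _        = case trans (sym lc) top of λ ()
    ... | no c′≢c  | no c′≢d  with small c′ c′≢c c′≢d
    ...   | _ , singleton , _ with ∷-injectiveʳ (trans (sym singleton) top)
    ...     | refl = case t∈rest of λ ()
    noRelocation c′ top t∈rest | no _ | yes refl with ∃-third 3≤C c d
    ...   | e , e≢c , e≢d with small e e≢c e≢d
    ...     | x , le , x<xd = <⇒≱ (<-≤-trans x<xd xd≤t) t≤x
      where
      t≤x : t ≤ x
      t≤x = All.lookup (proj₂ isTarget) (∈-column⇒∈-labels B e (subst (x ∈_) (sym le) (here refl)))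
      xd≤t : xd ≤ t
      xd≤t with subst (t ∈_) (sym (∷-injectiveʳ (trans (sym ld) top))) t∈rest
      ... | here refl         = xd≤r
      ... | there (here refl) = ≤-refl

  H-bound-c≡t : ∀ {B : Bay C} {n} c d {t a r xd} → d ≢ c → HRun P B n → Distinct B → size B ≤ C + 2 →
    target B ≡ t → lookup B c ≡ t ∷ [] → lookup B d ≡ a ∷ r ∷ xd ∷ [] → xd ≤ r →
    SmallSingletons B c d xd → n ≤ blockingCount B
  H-bound-c≡t c d d≢c (done _) _ _ _ _ _ _ _ = z≤n
  H-bound-c≡t {B = B} c d d≢c (relo rl _) dist _ refl lc _ _ _ =
    ⊥-elim (∉-below-singleton dist lc top (subst (_∈ rest) (sym (IsTarget⇒target≡ B isTarget)) notTop))
    where open Relocation rl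
  H-bound-c≡t {B = B} c d d≢c (retr rt run) dist size≤ refl lc ld xd≤r small
    with Distinct.column dist
           (subst (Retrieval.t rt ∈_) (sym (Retrieval.top rt)) (here refl))
           (subst (Retrieval.t rt ∈_) (sym lc) (here (sym (IsTarget⇒target≡ B (Retrieval.isTarget rt)))))
  ... | refl = ≤-trans
    (H-bound-c≡[] c d d≢c run (distinct dist) (size-retrieve-≤ 1 rt size≤)
       (trans lookup-c rest≡[]) (trans (lookup-other d≢c) ld) xd≤r (SmallSingletons-retrieve rt small))
    (≤-reflexive blockingCount≡)
    where
    open Retrieving rt
    open Retrieval rt using (rest; top)
    rest≡[] : rest ≡ []
    rest≡[] = ∷-injectiveʳ (trans (sym top) lc)

  H-bound-topmost : ∀ {B : Bay C} {n} → HRun P B n → Distinct B → size B ≤ C + 2 →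
    above (target B) B ≡ 0 → n ≤ blockingCount B + 1
  H-bound-topmost {B} {n} run dist size≤ above≡0 = begin
    n                                  ≤⟨ H-bound 1≤P run dist ⟩
    blockingCount B + Φ B              ≤⟨ +-monoʳ-≤ (blockingCount B) (begin
      Φ B                                  ≡⟨ cong (potential (excess B)) above≡0 ⟩
      tri (excess B) + 0                   ≡⟨ +-identityʳ _ ⟩
      tri (excess B)                       ≤⟨ tri-mono (excess≤ B 2 size≤) ⟩
      1                                    ∎) ⟩
    blockingCount B + 1                ∎
    where open ≤-Reasoning

  H-bound-c≡a∷t : ∀ {B : Bay C} {n} c d {t a r xd} → d ≢ c → HRun P B n → Distinct B →
    size B ≤ C + 2 → target B ≡ t → above t B ≤ 1 → lookup B c ≡ a ∷ t ∷ [] →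
    lookup B d ≡ r ∷ xd ∷ [] → xd ≤ r → SmallSingletons B c d xd → n ≤ blockingCount B + 1
  H-bound-c≡a∷t c d d≢c (done _) _ _ _ _ _ _ _ _ = z≤n
  H-bound-c≡a∷t c d d≢c (retr rt run) dist size≤ _ _ _ _ _ _ = H-bound-retrieve 1 rt run dist size≤
  H-bound-c≡a∷t {B} c d {xd = xd} d≢c (relo {B' = B′} {n = n} rl run) dist size≤ refl above≤1 lc ld xd≤r small
    with Relocation.choice rl
  ... | inj₁ (r<d , _) = begin
    suc n                          ≤⟨ s≤s (H-bound-topmost run (distinct dist) (≤-trans (≤-reflexive size≡) size≤)
                                           (trans (cong (λ x → above x B′) target′≡) above′≡0)) ⟩
    suc (blockingCount B′) + 1     ≤⟨ +-monoˡ-≤ 1 (blockingCount-< dist r<d) ⟩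
    blockingCount B + 1            ∎
    where
    open ≤-Reasoning
    open Relocating rl
    open Relocation rl using (t)
    target′≡ : target B′ ≡ t
    target′≡ = IsTarget⇒target≡ B′ isTarget′
    above′≡0 : above t B′ ≡ 0
    above′≡0 = n≤0⇒n≡0 (≤-pred (≤-trans (above-< dist)
                 (subst (λ x → above x B ≤ 1) (IsTarget⇒target≡ B (Relocation.isTarget rl)) above≤1)))
  ... | inj₂ (_ , maxd)
    with Distinct.column dist (Relocating.rest⊆c rl (Relocation.notTop rl))
           (subst (Relocation.t rl ∈_) (sym lc) (there (here (sym (IsTarget⇒target≡ B (Relocation.isTarget rl))))))
  ...   | refl with ∷-injectiveˡ (trans (sym lc) (Relocation.top rl))
  ...     | refl with Relocation.d rl Fin.≟ d
  ...       | yes refl =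
    ≤-trans (s≤s afterSecondMove) (≤-trans (s≤s (blockingCount-≤ dist)) (≤-reflexive (+-comm 1 _)))
    where
    open Relocating rl hiding (d≢c)
    target′≡ : target B′ ≡ target B
    target′≡ = trans (IsTarget⇒target≡ B′ isTarget′) (sym (IsTarget⇒target≡ B (Relocation.isTarget rl)))
    rest≡ : Relocation.rest rl ≡ target B ∷ []
    rest≡ = ∷-injectiveʳ (trans (sym (Relocation.top rl)) lc)
    afterSecondMove : n ≤ blockingCount B′
    afterSecondMove = H-bound-c≡t c d d≢c run (distinct dist) (≤-trans (≤-reflexive size≡) size≤) target′≡
      (trans lookup-c rest≡) (trans lookup-d (cong (Relocation.r rl ∷_) ld)) xd≤r
      (SmallSingletons-relocate rl small)
  -- Any other candidate is a singleton below xd ≤ colMin d, so H stacks a onto d.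
  ...       | no d′≢d with small (Relocation.d rl) (Relocating.d≢c rl) d′≢d
  ...         | x , ld′ , x<xd = ⊥-elim (<⇒≱ x<xd (begin
    xd                     ≤⟨ ≤colMin B d (subst (xd ∈_) (sym ld) (there (here refl)))
                                          (subst (All (xd ≤_)) (sym ld) (xd≤r ∷ ≤-refl ∷ [])) ⟩
    colMin B d             ≤⟨ maxd d (d≢c , subst (λ col → length col < P) (sym ld) 3≤P) ⟩
    colMin B (Relocation.d rl) ≡⟨ colMin-[ B ] (Relocation.d rl) ld′ ⟩
    x                      ∎))
    where open ≤-Reasoning

  H-bound-excess≤2 : ∀ {B : Bay C} {n} → HRun P B n → Distinct B → size B ≤ C + 2 →
    n ≤ blockingCount B + 2
  H-bound-excess≤2 (done _) _ _ = z≤n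
  H-bound-excess≤2 (retr rt run) dist size≤ =
    ≤-trans (H-bound-retrieve 1 rt run dist size≤) (+-monoʳ-≤ _ (n≤1+n 1))
  H-bound-excess≤2 {B} (relo {B' = B′} {n = n} rl run) dist size≤ = byChoice choice
    where
    open Relocation rl
    open Relocating rl
    size≤′ : size B′ ≤ C + 2
    size≤′ = subst (_≤ C + 2) (sym size≡) size≤
    byChoice : HChoice P B c r d → suc n ≤ blockingCount B + 2
    byChoice (inj₁ (r<d , _)) =
      ≤-trans (s≤s (H-bound-excess≤2 run (distinct dist) size≤′)) (+-monoˡ-≤ 2 (blockingCount-< dist r<d))
    byChoice (inj₂ (allBelow , maxd)) = ≤-trans (s≤s (afterBadMove (above t B′) refl))
      (≤-trans (≤-reflexive (sym (+-suc (blockingCount B′) 1))) (+-monoˡ-≤ 2 (blockingCount-≤ dist)))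
      where
      nonempty = noEmptyColumn B c r rest 1≤P top allBelow
      above≤2 : above t B ≤ 2
      above≤2 = ≤-trans (above≤excess B t nonempty) (excess≤ B 2 size≤)
      target′≡ : target B′ ≡ t
      target′≡ = IsTarget⇒target≡ B′ isTarget′
      afterBadMove : ∀ s → above t B′ ≡ s → n ≤ blockingCount B′ + 1
      afterBadMove zero    above′≡0 =
        H-bound-topmost run (distinct dist) size≤′ (trans (cong (λ x → above x B′) target′≡) above′≡0)
      afterBadMove (suc _) above′≡suc =
        H-bound-c≡a∷t c d d≢c run (distinct dist) size≤′ target′≡
          (≤-pred (≤-trans (above-< dist) above≤2))
          (trans lookup-c (proj₂ (proj₁ shape)))
          (trans lookup-d (cong (r ∷_) ld))
          (≤-trans (≤-reflexive (sym (colMin-[ B ] d ld))) (allBelow d cand))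
          (SmallSingletons-relocate rl
            (SmallSingletons-maximal (≤-trans (s≤s (s≤s z≤n)) 3≤P) dist ld maxd (proj₂ shape)))
        where
        shape = bad-move-shape dist top notTop nonempty size≤
          (≤-trans (s≤s (s≤s z≤n)) (≤-trans (≤-reflexive (cong suc (sym above′≡suc))) (above-< dist)))
        ld : lookup B d ≡ proj₁ (proj₂ shape d d≢c) ∷ []
        ld = proj₂ (proj₂ shape d d≢c)

proposition6 : (C P k : ℕ) → P ≤ C → 3 ≤ P → (B : Bay C) → WellFormed P B
    → size B ≤ C + k → (zH zopt : ℕ) → HRun P B zH → IsZopt P B zopt
    → (k ≡ 2 → zH ≤ zopt + 2)
    × (3 ≤ k → k ≤ C → zH ≤ zopt + (k * suc k) / 2)
proposition6 C P k P≤C 3≤P B (_ , unique) size≤ zH zopt run (optimal , _) = excess≡2 , excess≥3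
  where
  1≤P : 1 ≤ P
  1≤P = ≤-trans (s≤s z≤n) 3≤P
  dist : Distinct B
  dist = Unique-labels⇒Distinct B unique
  lower : blockingCount B ≤ zopt
  lower = blockingCount≤relocations optimal
  excess≡2 : k ≡ 2 → zH ≤ zopt + 2
  excess≡2 refl = ≤-trans (H-bound-excess≤2 3≤P (≤-trans 3≤P P≤C) run dist size≤) (+-monoˡ-≤ 2 lower)
  excess≥3 : 3 ≤ k → k ≤ C → zH ≤ zopt + (k * suc k) / 2
  excess≥3 _ _ = ≤-trans (H-bound-excess 1≤P k run dist size≤) (+-mono-≤ lower (≤-reflexive (tri-suc≡ k)))
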